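{- Let $m\ge2$ and $a\in\mathbb{Q}^{m(m-1)/2}$. Then there exist a rational number $r$ and an $m$-Hadamardesque matrix $M$, all of whose entries are of the form $\pm r$, whose rows $r_1,\dots,r_m$ satisfy $$\langle r_i,r_j\rangle=a_{\frac{(j-1)(j-2)}{2}+i}\qquad\text{for all }1\le i<j\le m.$$
   Context: The matrices $T_m$ ($m\times 2^{m-1}$) are defined recursively by $T_1=[1]$ and $T_{m+1}=\begin{bmatrix} T_m & T_m\\ 1\cdots 1 & -1\cdots -1\end{bmatrix}$ (last row: $2^{m-1}$ ones then $2^{m-1}$ minus ones); its columns are all vectors $(1,\pm1,\dots,\pm1)\in\mathbb{R}^m$. An $m\times n$ real matrix $M$ is $m$-Hadamardesque if each of its columns equals $p\,c$ for some $p>0$ and some column $c$ of $T_m$. -}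

module Defs where

open import Data.Nat using (ℕ; zero; suc)
import Data.Nat as ℕ
open import Data.Fin using (Fin; zero; suc; splitAt)
open import Data.Maybe using (Maybe; just; nothing)
import Data.Maybe as Maybe
open import Data.Sum using (inj₁; inj₂)
open import Data.Product using (Σ; ∃; _×_)
open import Data.Empty using (⊥)
open import Data.Rational using (ℚ; _+_; _*_; -_; 0ℚ; 1ℚ; _<_)
open import Relation.Binary.PropositionalEquality using (_≡_)

Matrix : ℕ → ℕ → Set
Matrix m n = Fin m → Fin n → ℚ

lastOr : ∀ {n} → Fin (suc n) → Maybe (Fin n)
lastOr {zero} zero = nothing
lastOr {suc n} zero = just zero
lastOr {suc n} (suc i) = Maybe.map suc (lastOr i)

-- pow2 k = 2^k (defined so that 2^(k+1) = 2^k + 2^k definitionally).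
pow2 : ℕ → ℕ
pow2 zero = 1
pow2 (suc k) = pow2 k ℕ.+ pow2 k

-- T k is the paper's T_{k+1}, a (k+1) × 2^k matrix:
-- T_1 = [1],  T_{m+1} = [ T_m  T_m ; 1…1  -1…-1 ].
T : (k : ℕ) → Matrix (suc k) (pow2 k)
T zero _ _ = 1ℚ
T (suc k) r c with lastOr r | splitAt (pow2 k) c
... | just r' | inj₁ c' = T k r' c'
... | just r' | inj₂ c' = T k r' c'
... | nothing | inj₁ _  = 1ℚ
... | nothing | inj₂ _  = - 1ℚ

-- M (m × n) is m-Hadamardesque: every column is p·c with p > 0 and c a column of T_m.
-- (T_m only exists for m ≥ 1; for m = 0 the notion is undefined, rendered as ⊥.)
Hadamardesque : (m n : ℕ) → Matrix m n → Set
Hadamardesque zero n M = ⊥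
Hadamardesque (suc k) n M =
  (col : Fin n) → Σ ℚ λ p → (0ℚ < p) × (Σ (Fin (pow2 k)) λ c →
     (row : Fin (suc k)) → M row col ≡ p * T k row c)

dot : (n : ℕ) → (Fin n → ℚ) → (Fin n → ℚ) → ℚ
dot zero u v = 0ℚ
dot (suc n) u v = u zero * v zero + dot n (λ i → u (suc i)) (λ i → v (suc i))

{-# OPTIONS --safe #-}

-- The rows of T_m are characters of (ℤ/2)^(m-1), row 1 being the trivial one, and
-- for i < j the products r_i r_j are pairwise distinct nontrivial characters.  By
-- orthogonality, weighting each column c of T_m by U + V + (U - V) r_i(c) r_j(c)
-- contributes 2^(m-1) (U - V) to ⟨r_i, r_j⟩ and nothing to any other pair, so
-- concatenating such blocks realises arbitrary integer targets.  Rational targets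
-- follow by clearing denominators and scaling the whole matrix by a suitable 1/N.
module Submission where

open import Defs
open import Algebra.Bundles using (CommutativeMonoid; CommutativeRing)
open import Data.Bool using (Bool; true; false; if_then_else_; _xor_)
open import Data.Empty using (⊥-elim)
open import Data.Maybe using (just; nothing)
import Data.Maybe as Maybe
open import Data.Fin using (Fin; zero; suc; toℕ; inject₁; fromℕ; splitAt; _↑ˡ_; _↑ʳ_; combine; remQuot)
import Data.Fin as Fin
open import Data.Fin.Properties using (<⇒≢; <-cmp; <-trans; fromℕ≢inject₁; inject₁-injective; punchInᵢ≢i; splitAt-↑ˡ; splitAt-↑ʳ; remQuot-combine; toℕ-injective; any?)
open import Data.Fin.Relation.Unary.Top using (view; ‵fromℕ; ‵inject₁)
open import Data.List using (List; []; _∷_; _++_; concat; replicate; tabulate; length; lookup)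
open import Data.Nat using (ℕ; zero; suc)
import Data.Nat as ℕ
import Data.Nat.Properties as ℕₚ
open import Data.Product using (Σ; ∃; ∃₂; _×_; _,_; proj₁; proj₂; uncurry)
open import Data.Sum using (_⊎_; inj₁; inj₂; [_,_]′)
open import Function using (_∘_; id; const)
open import Relation.Binary.Definitions using (Tri; tri<; tri≈; tri>)
open import Relation.Binary.PropositionalEquality
open import Relation.Nullary using (Dec; yes; no; does)
open import Relation.Nullary.Decidable using (dec-true; dec-false)

module _ where

  import Data.Integer as ℤ
  import Data.Integer.Properties as ℤ
  open import Data.Rational using (ℚ; mkℚ; _+_; _*_; -_; _-_; 0ℚ; 1ℚ; 1/_; Positive; NonNegative; toℚᵘ)
  import Data.Rational as ℚ
  open import Data.Rational.Properties
    using ( _≟_; +-identityˡ; +-identityʳ; +-assoc; *-identityˡ; *-identityʳ; *-assoc; *-zeroʳ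
          ; *-distribˡ-+; *-inverseˡ; neg-distribʳ-*; +-*-commutativeRing; *-1-commutativeMonoid
          ; nonNeg+nonNeg⇒nonNeg; pos+nonNeg⇒pos; pos⇒nonZero; 1/pos⇒pos; positive⁻¹
          ; toℚᵘ-cong; toℚᵘ-injective; toℚᵘ-homo-+; toℚᵘ-homo-*; toℚᵘ-homo‿- )
  import Data.Rational.Unnormalised as ℚᵘ
  import Data.Rational.Unnormalised.Properties as ℚᵘ
  open import Data.Rational.Solver using (module +-*-Solver)
  open +-*-Solver using (solve; _:+_; _:-_; _:*_; :-_; _:=_; con)
  open import Algebra.Properties.CommutativeSemigroup (CommutativeMonoid.commutativeSemigroup *-1-commutativeMonoid) using (interchange)
  open import Algebra.Properties.Semiring.Sum (CommutativeRing.semiring +-*-commutativeRing) using (sum; sum-syntax; sum-cong-≗; sum-remove; sum-replicate; sum-replicate-zero; ∑-distrib-+; *-distribˡ-sum)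
  open import Algebra.Properties.Semiring.Mult (CommutativeRing.semiring +-*-commutativeRing) using (×-homo-+; ×-assoc-*; ×1-homo-*) renaming (_×_ to _·_)
  open ≡-Reasoning

  ∑-zero : ∀ {n} (f : Fin n → ℚ) → (∀ i → f i ≡ 0ℚ) → sum f ≡ 0ℚ
  ∑-zero {n} f f≡0 = trans (sum-cong-≗ f≡0) (sum-replicate-zero n)

  ∑-δ : ∀ {n} (f : Fin (suc n) → ℚ) i → (∀ j → j ≢ i → f j ≡ 0ℚ) → sum f ≡ f i
  ∑-δ f i f≡0 = begin
    sum f                              ≡⟨ sum-remove f ⟩
    f i + sum (f ∘ Fin.punchIn i)      ≡⟨ cong (f i +_) (∑-zero _ (λ j → f≡0 _ (punchInᵢ≢i i j))) ⟩
    f i + 0ℚ                           ≡⟨ +-identityʳ (f i) ⟩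
    f i                                ∎

  ∑-splitAt : ∀ m {n} (f : Fin (m ℕ.+ n) → ℚ) → sum f ≡ sum (λ i → f (i ↑ˡ n)) + sum (λ i → f (m ↑ʳ i))
  ∑-splitAt zero    f = sym (+-identityˡ (sum f))
  ∑-splitAt (suc m) f = trans (cong (f zero +_) (∑-splitAt m (f ∘ suc))) (sym (+-assoc (f zero) _ _))

  sumOver : {A : Set} → (A → ℚ) → List A → ℚ
  sumOver f []       = 0ℚ
  sumOver f (x ∷ xs) = f x + sumOver f xs

  sumOver-++ : ∀ {A : Set} (f : A → ℚ) xs ys → sumOver f (xs ++ ys) ≡ sumOver f xs + sumOver f ys
  sumOver-++ f []       ys = sym (+-identityˡ _)
  sumOver-++ f (x ∷ xs) ys = trans (cong (f x +_) (sumOver-++ f xs ys)) (sym (+-assoc (f x) _ _))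

  sumOver-concat-tabulate : ∀ {A : Set} (f : A → ℚ) n (g : Fin n → List A) →
    sumOver f (concat (tabulate g)) ≡ ∑[ i < n ] sumOver f (g i)
  sumOver-concat-tabulate f zero    g = refl
  sumOver-concat-tabulate f (suc n) g =
    trans (sumOver-++ f (g zero) _) (cong (sumOver f (g zero) +_) (sumOver-concat-tabulate f n (g ∘ suc)))

  sumOver-replicate : ∀ {A : Set} (f : A → ℚ) n x → sumOver f (replicate n x) ≡ n · f x
  sumOver-replicate f zero    x = refl
  sumOver-replicate f (suc n) x = cong (f x +_) (sumOver-replicate f n x)

  dot-lookup : ∀ {A : Set} r (f g : A → ℚ) xs →
    dot (length xs) (λ c → r * f (lookup xs c)) (λ c → r * g (lookup xs c)) ≡ r * r * sumOver (λ x → f x * g x) xs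
  dot-lookup r f g []       = sym (*-zeroʳ (r * r))
  dot-lookup r f g (x ∷ xs) = begin
    r * f x * (r * g x) + dot (length xs) _ _      ≡⟨ cong₂ _+_ (interchange r (f x) r (g x)) (dot-lookup r f g xs) ⟩
    r * r * (f x * g x) + r * r * sumOver _ xs     ≡⟨ sym (*-distribˡ-+ (r * r) _ _) ⟩
    r * r * sumOver (λ y → f y * g y) (x ∷ xs)     ∎

  ·-as-* : ∀ n x → n · x ≡ n · 1ℚ * x
  ·-as-* n x = sym (trans (×-assoc-* n 1ℚ x) (cong (n ·_) (*-identityˡ x)))

  ·1-*-assoc : ∀ m n x → (m ℕ.* n) · 1ℚ * x ≡ m · 1ℚ * (n · 1ℚ * x)
  ·1-*-assoc m n x = trans (cong (_* x) (×1-homo-* m n)) (*-assoc (m · 1ℚ) (n · 1ℚ) x)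

  ·1-*-difference : ∀ n u v → (n ℕ.* u) · 1ℚ - (n ℕ.* v) · 1ℚ ≡ n · 1ℚ * (u · 1ℚ - v · 1ℚ)
  ·1-*-difference n u v = begin
    (n ℕ.* u) · 1ℚ - (n ℕ.* v) · 1ℚ            ≡⟨ cong₂ _-_ (×1-homo-* n u) (×1-homo-* n v) ⟩
    n · 1ℚ * u · 1ℚ - n · 1ℚ * v · 1ℚ          ≡⟨ solve 3 (λ n u v → n :* u :- n :* v := n :* (u :- v)) refl (n · 1ℚ) (u · 1ℚ) (v · 1ℚ) ⟩
    n · 1ℚ * (u · 1ℚ - v · 1ℚ)                 ∎

  ·1-nonNegative : ∀ n → NonNegative (n · 1ℚ)
  ·1-nonNegative zero    = _
  ·1-nonNegative (suc n) = nonNeg+nonNeg⇒nonNeg 1ℚ {{_}} (n · 1ℚ) {{·1-nonNegative n}}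

  ·1-positive : ∀ n .{{_ : ℕ.NonZero n}} → Positive (n · 1ℚ)
  ·1-positive (suc n) = pos+nonNeg⇒pos 1ℚ {{_}} (n · 1ℚ) {{·1-nonNegative n}}

  ·1-toℚᵘ : ∀ n → toℚᵘ (n · 1ℚ) ℚᵘ.≃ ℚᵘ.mkℚᵘ (ℤ.+ n) 0
  ·1-toℚᵘ zero    = ℚᵘ.≃-refl
  ·1-toℚᵘ (suc n) =
    ℚᵘ.≃-trans (toℚᵘ-homo-+ 1ℚ (n · 1ℚ))
    (ℚᵘ.≃-trans (ℚᵘ.+-congʳ (toℚᵘ 1ℚ) (·1-toℚᵘ n))
    (ℚᵘ.*≡* (cong (λ z → (ℤ.+ 1 ℤ.+ z) ℤ.* ℤ.+ 1) (ℤ.*-identityʳ (ℤ.+ n)))))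

  IsInteger : ℚ → Set
  IsInteger q = ∃₂ λ u v → q ≡ u · 1ℚ - v · 1ℚ

  IsInteger-·1* : ∀ n {q} → IsInteger q → IsInteger (n · 1ℚ * q)
  IsInteger-·1* n (u , v , refl) = n ℕ.* u , n ℕ.* v , sym (·1-*-difference n u v)

  integer-toℚᵘ : ∀ z → ∃₂ λ u v → toℚᵘ (u · 1ℚ - v · 1ℚ) ℚᵘ.≃ ℚᵘ.mkℚᵘ z 0
  integer-toℚᵘ (ℤ.+ n)    = n , 0 , ℚᵘ.≃-trans (toℚᵘ-cong (+-identityʳ (n · 1ℚ))) (·1-toℚᵘ n)
  integer-toℚᵘ ℤ.-[1+ n ] = 0 , suc n ,
    ℚᵘ.≃-trans (toℚᵘ-cong (+-identityˡ _)) (ℚᵘ.≃-trans (toℚᵘ-homo‿- (suc n · 1ℚ)) (ℚᵘ.-‿cong (·1-toℚᵘ (suc n))))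

  clearDenominator : ∀ q → IsInteger (ℚ.denominatorℕ q · 1ℚ * q)
  clearDenominator (mkℚ z d _) with integer-toℚᵘ z
  ... | u , v , u-v≃z = u , v , toℚᵘ-injective
    (ℚᵘ.≃-trans (toℚᵘ-homo-* (suc d · 1ℚ) _)
    (ℚᵘ.≃-trans (ℚᵘ.*-congʳ (·1-toℚᵘ (suc d)))
    (ℚᵘ.≃-trans (ℚᵘ.*≡* d*z≡z*d) (ℚᵘ.≃-sym u-v≃z))))
    where
    d*z≡z*d : (ℤ.+ suc d ℤ.* z) ℤ.* ℤ.+ 1 ≡ z ℤ.* ℤ.+ (1 ℕ.* suc d)
    d*z≡z*d = trans (ℤ.*-identityʳ _) (trans (ℤ.*-comm (ℤ.+ suc d) z) (cong (λ n → z ℤ.* ℤ.+ n) (sym (ℕₚ.*-identityˡ (suc d)))))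

  commonDenominator : ∀ N (f : Fin N → ℚ) → ∃ λ D → ∀ x → IsInteger (suc D · 1ℚ * f x)
  commonDenominator zero    f = 0 , λ ()
  commonDenominator (suc N) f with commonDenominator N (f ∘ suc)
  ... | D , clears = D ℕ.+ d ℕ.* suc D , clears′
    where
    d : ℕ
    d = ℚ.denominator-1 (f zero)
    clears′ : ∀ x → IsInteger ((suc d ℕ.* suc D) · 1ℚ * f x)
    clears′ zero    = subst IsInteger
      (sym (trans (cong (λ n → n · 1ℚ * f zero) (ℕₚ.*-comm (suc d) (suc D))) (·1-*-assoc (suc D) (suc d) (f zero))))
      (IsInteger-·1* (suc D) (clearDenominator (f zero)))
    clears′ (suc x) = subst IsInteger (sym (·1-*-assoc (suc d) (suc D) (f (suc x)))) (IsInteger-·1* (suc d) (clears x))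

  foldColumn : ∀ k → Fin (pow2 (suc k)) → Fin (pow2 k)
  foldColumn k c = [ id , id ]′ (splitAt (pow2 k) c)

  lastRow : ∀ k → Fin (pow2 (suc k)) → ℚ
  lastRow k c = [ const 1ℚ , const (- 1ℚ) ]′ (splitAt (pow2 k) c)

  lastOr-inject₁ : ∀ {n} (r : Fin (suc n)) → lastOr (inject₁ r) ≡ just r
  lastOr-inject₁ {zero}  zero    = refl
  lastOr-inject₁ {suc n} zero    = refl
  lastOr-inject₁ {suc n} (suc r) = cong (Maybe.map suc) (lastOr-inject₁ r)

  lastOr-fromℕ : ∀ n → lastOr (fromℕ n) ≡ nothing
  lastOr-fromℕ zero    = refl
  lastOr-fromℕ (suc n) = cong (Maybe.map suc) (lastOr-fromℕ n)

  T-inject₁ : ∀ k r c → T (suc k) (inject₁ r) c ≡ T k r (foldColumn k c)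
  T-inject₁ k r c with lastOr (inject₁ r) | lastOr-inject₁ r | splitAt (pow2 k) c
  ... | just .r | refl | inj₁ _ = refl
  ... | just .r | refl | inj₂ _ = refl

  T-fromℕ : ∀ k c → T (suc k) (fromℕ (suc k)) c ≡ lastRow k c
  T-fromℕ k c with lastOr (fromℕ (suc k)) | lastOr-fromℕ (suc k) | splitAt (pow2 k) c
  ... | nothing | refl | inj₁ _ = refl
  ... | nothing | refl | inj₂ _ = refl

  IsSign : ℚ → Set
  IsSign x = x ≡ 1ℚ ⊎ x ≡ - 1ℚ

  IsSign-* : ∀ {x y} → IsSign x → IsSign y → IsSign (x * y)
  IsSign-* (inj₁ refl) (inj₁ refl) = inj₁ refl
  IsSign-* (inj₁ refl) (inj₂ refl) = inj₂ refl
  IsSign-* (inj₂ refl) (inj₁ refl) = inj₂ refl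
  IsSign-* (inj₂ refl) (inj₂ refl) = inj₁ refl

  IsSign⇒square≡1 : ∀ {x} → IsSign x → x * x ≡ 1ℚ
  IsSign⇒square≡1 (inj₁ refl) = refl
  IsSign⇒square≡1 (inj₂ refl) = refl

  lastRow-sign : ∀ k c → IsSign (lastRow k c)
  lastRow-sign k c with splitAt (pow2 k) c
  ... | inj₁ _ = inj₁ refl
  ... | inj₂ _ = inj₂ refl

  T-sign : ∀ k r c → IsSign (T k r c)
  T-sign zero    zero c = inj₁ refl
  T-sign (suc k) r    c with view r
  ... | ‵fromℕ      = subst IsSign (sym (T-fromℕ k c)) (lastRow-sign k c)
  ... | ‵inject₁ r′ = subst IsSign (sym (T-inject₁ k r′ c)) (T-sign k r′ (foldColumn k c))

  -- χ k e is the product of the rows of T k selected by e.  Row zero of T k is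
  -- constantly 1, which is why e zero is never consulted.
  χ : ∀ k → (Fin (suc k) → Bool) → Fin (pow2 k) → ℚ
  χ zero    e c = 1ℚ
  χ (suc k) e c = (if e (fromℕ (suc k)) then lastRow k c else 1ℚ) * χ k (e ∘ inject₁) (foldColumn k c)

  _⊕_ : ∀ {n} → (Fin n → Bool) → (Fin n → Bool) → Fin n → Bool
  (e ⊕ e′) r = e r xor e′ r

  δ : ∀ {n} → Fin n → Fin n → Bool
  δ a r = does (r Fin.≟ a)

  δ-self : ∀ {n} (a : Fin n) → δ a a ≡ true
  δ-self a = dec-true (a Fin.≟ a) refl

  δ-≢ : ∀ {n} {a r : Fin n} → r ≢ a → δ a r ≡ false
  δ-≢ {a = a} {r} r≢a = dec-false (r Fin.≟ a) r≢a

  δ-inject₁ : ∀ {n} (a r : Fin n) → δ (inject₁ a) (inject₁ r) ≡ δ a r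
  δ-inject₁ a r with r Fin.≟ a
  ... | yes refl = δ-self (inject₁ a)
  ... | no r≢a   = δ-≢ (r≢a ∘ inject₁-injective)

  χ-cong : ∀ k {e e′} → (∀ r → e r ≡ e′ r) → ∀ c → χ k e c ≡ χ k e′ c
  χ-cong zero    e≗e′ c = refl
  χ-cong (suc k) e≗e′ c =
    cong₂ (λ b x → (if b then lastRow k c else 1ℚ) * x) (e≗e′ (fromℕ (suc k))) (χ-cong k (e≗e′ ∘ inject₁) (foldColumn k c))

  χ-none : ∀ k e → (∀ r → e r ≡ false) → ∀ c → χ k e c ≡ 1ℚ
  χ-none zero    e e≡false c = refl
  χ-none (suc k) e e≡false c rewrite e≡false (fromℕ (suc k)) =
    trans (*-identityˡ _) (χ-none k (e ∘ inject₁) (e≡false ∘ inject₁) (foldColumn k c))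

  if-xor : ∀ x y {h} → IsSign h → (if x xor y then h else 1ℚ) ≡ (if x then h else 1ℚ) * (if y then h else 1ℚ)
  if-xor false false h = refl
  if-xor false true  h = sym (*-identityˡ _)
  if-xor true  false h = sym (*-identityʳ _)
  if-xor true  true  h = sym (IsSign⇒square≡1 h)

  χ-⊕ : ∀ k e e′ c → χ k (e ⊕ e′) c ≡ χ k e c * χ k e′ c
  χ-⊕ zero    e e′ c = refl
  χ-⊕ (suc k) e e′ c =
    trans (cong₂ _*_ (if-xor b b′ (lastRow-sign k c)) (χ-⊕ k (e ∘ inject₁) (e′ ∘ inject₁) c′))
          (interchange (sign b) (sign b′) (χ k (e ∘ inject₁) c′) (χ k (e′ ∘ inject₁) c′))
    where
    b b′ : Bool
    b = e (fromℕ (suc k))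
    b′ = e′ (fromℕ (suc k))
    c′ : Fin (pow2 k)
    c′ = foldColumn k c
    sign : Bool → ℚ
    sign x = if x then lastRow k c else 1ℚ

  χ-δ : ∀ k a c → χ k (δ a) c ≡ T k a c
  χ-δ zero    zero c = refl
  χ-δ (suc k) a    c with view a
  ... | ‵fromℕ = begin
    (if δ a a then lastRow k c else 1ℚ) * χ k (δ a ∘ inject₁) (foldColumn k c)
      ≡⟨ cong₂ (λ b x → (if b then lastRow k c else 1ℚ) * x) (δ-self a)
               (χ-none k _ (λ r → δ-≢ (fromℕ≢inject₁ {i = r} ∘ sym)) (foldColumn k c)) ⟩
    lastRow k c * 1ℚ
      ≡⟨ *-identityʳ _ ⟩
    lastRow k c
      ≡⟨ sym (T-fromℕ k c) ⟩
    T (suc k) a c ∎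
  ... | ‵inject₁ a′ = begin
    (if δ a (fromℕ (suc k)) then lastRow k c else 1ℚ) * χ k (δ a ∘ inject₁) (foldColumn k c)
      ≡⟨ cong₂ (λ b x → (if b then lastRow k c else 1ℚ) * x) (δ-≢ (fromℕ≢inject₁ {i = a′}))
               (χ-cong k (δ-inject₁ a′) (foldColumn k c)) ⟩
    1ℚ * χ k (δ a′) (foldColumn k c)
      ≡⟨ *-identityˡ _ ⟩
    χ k (δ a′) (foldColumn k c)
      ≡⟨ χ-δ k a′ (foldColumn k c) ⟩
    T k a′ (foldColumn k c)
      ≡⟨ sym (T-inject₁ k a′ c) ⟩
    T (suc k) a c ∎

  ∑χ-suc : ∀ k e → let S = ∑[ c < pow2 k ] χ k (e ∘ inject₁) c in
    ∑[ c < pow2 (suc k) ] χ (suc k) e c ≡ S + (if e (fromℕ (suc k)) then - 1ℚ else 1ℚ) * S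
  ∑χ-suc k e = begin
    ∑[ c < pow2 (suc k) ] χ (suc k) e c
      ≡⟨ ∑-splitAt (pow2 k) (χ (suc k) e) ⟩
    ∑[ c < pow2 k ] χ (suc k) e (c ↑ˡ pow2 k) + ∑[ c < pow2 k ] χ (suc k) e (pow2 k ↑ʳ c)
      ≡⟨ cong₂ _+_ (sum-cong-≗ left) (trans (sum-cong-≗ right) (sym (*-distribˡ-sum s (χ k e′)))) ⟩
    ∑[ c < pow2 k ] χ k e′ c + s * ∑[ c < pow2 k ] χ k e′ c ∎
    where
    e′ : Fin (suc k) → Bool
    e′ = e ∘ inject₁
    s : ℚ
    s = if e (fromℕ (suc k)) then - 1ℚ else 1ℚ
    left : ∀ c → χ (suc k) e (c ↑ˡ pow2 k) ≡ χ k e′ c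
    left c rewrite splitAt-↑ˡ (pow2 k) c (pow2 k) with e (fromℕ (suc k))
    ... | true  = *-identityˡ _
    ... | false = *-identityˡ _
    right : ∀ c → χ (suc k) e (pow2 k ↑ʳ c) ≡ s * χ k e′ c
    right c rewrite splitAt-↑ʳ (pow2 k) (pow2 k) c = refl

  ∑χ≡0 : ∀ k e (r : Fin (suc k)) → r ≢ zero → e r ≡ true → ∑[ c < pow2 k ] χ k e c ≡ 0ℚ
  ∑χ≡0 zero    e zero r≢0 _ = ⊥-elim (r≢0 refl)
  ∑χ≡0 (suc k) e r    r≢0 er with view r
  ... | ‵fromℕ = begin
    ∑[ c < pow2 (suc k) ] χ (suc k) e c
      ≡⟨ ∑χ-suc k e ⟩
    S + (if e r then - 1ℚ else 1ℚ) * S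
      ≡⟨ cong (λ b → S + (if b then - 1ℚ else 1ℚ) * S) er ⟩
    S + - 1ℚ * S
      ≡⟨ solve 1 (λ S → S :+ :- con 1ℚ :* S := con 0ℚ) refl S ⟩
    0ℚ ∎
    where
    S : ℚ
    S = ∑[ c < pow2 k ] χ k (e ∘ inject₁) c
  ... | ‵inject₁ r′ = begin
    ∑[ c < pow2 (suc k) ] χ (suc k) e c
      ≡⟨ ∑χ-suc k e ⟩
    S + s * S
      ≡⟨ cong (λ x → x + s * x) (∑χ≡0 k (e ∘ inject₁) r′ (r≢0 ∘ cong inject₁) er) ⟩
    0ℚ + s * 0ℚ
      ≡⟨ trans (+-identityˡ _) (*-zeroʳ s) ⟩
    0ℚ ∎
    where
    S s : ℚ
    S = ∑[ c < pow2 k ] χ k (e ∘ inject₁) c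
    s = if e (fromℕ (suc k)) then - 1ℚ else 1ℚ

  TT : ∀ k → Fin (suc k) → Fin (suc k) → Fin (pow2 k) → ℚ
  TT k a b c = T k a c * T k b c

  TT-sign : ∀ k a b c → IsSign (TT k a b c)
  TT-sign k a b c = IsSign-* (T-sign k a c) (T-sign k b c)

  TT-χ : ∀ k a b c → TT k a b c ≡ χ k (δ a ⊕ δ b) c
  TT-χ k a b c = sym (trans (χ-⊕ k (δ a) (δ b) c) (cong₂ _*_ (χ-δ k a c) (χ-δ k b c)))

  >⇒≢zero : ∀ {n} {a b : Fin (suc n)} → a Fin.< b → b ≢ zero
  >⇒≢zero a<b refl = ℕₚ.n≮0 a<b

  ∑TT≡0 : ∀ k {a b} → a Fin.< b → ∑[ c < pow2 k ] TT k a b c ≡ 0ℚ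
  ∑TT≡0 k {a} {b} a<b = trans (sum-cong-≗ (TT-χ k a b)) (∑χ≡0 k (δ a ⊕ δ b) b (>⇒≢zero a<b) δa⊕δb≡true)
    where
    δa⊕δb≡true : (δ a ⊕ δ b) b ≡ true
    δa⊕δb≡true = cong₂ _xor_ (δ-≢ (<⇒≢ a<b ∘ sym)) (δ-self b)

  ∑TT*TT≡pow2 : ∀ k a b → ∑[ c < pow2 k ] (TT k a b c * TT k a b c) ≡ pow2 k · 1ℚ
  ∑TT*TT≡pow2 k a b = trans (sum-cong-≗ (IsSign⇒square≡1 ∘ TT-sign k a b)) (sum-replicate (pow2 k))

  -- The product of the rows of two distinct pairs is the character of their symmetric difference,
  -- which contains a nonzero row: the larger of j, b if they differ, else the larger of i, a.
  ∑TT*TT≡0 : ∀ k {i j a b} → i Fin.< j → a Fin.< b → (i , j) ≢ (a , b) →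
    ∑[ c < pow2 k ] (TT k i j c * TT k a b c) ≡ 0ℚ
  ∑TT*TT≡0 k {i} {j} {a} {b} i<j a<b ij≢ab =
    trans (sum-cong-≗ asχ) (oddRow (<-cmp j b))
    where
    e : Fin (suc k) → Bool
    e = (δ i ⊕ δ j) ⊕ (δ a ⊕ δ b)
    asχ : ∀ c → TT k i j c * TT k a b c ≡ χ k e c
    asχ c = sym (trans (χ-⊕ k _ _ c) (cong₂ _*_ (sym (TT-χ k i j c)) (sym (TT-χ k a b c))))
    ≢< : ∀ {x y} → x Fin.< y → y ≢ x
    ≢< x<y = <⇒≢ x<y ∘ sym
    oddRow : Tri (j Fin.< b) (j ≡ b) (b Fin.< j) → ∑[ c < pow2 k ] χ k e c ≡ 0ℚ
    oddRow (tri< j<b _ _) = ∑χ≡0 k e b (>⇒≢zero a<b)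
      (cong₂ _xor_ (cong₂ _xor_ (δ-≢ (≢< (<-trans i<j j<b))) (δ-≢ (≢< j<b))) (cong₂ _xor_ (δ-≢ (≢< a<b)) (δ-self b)))
    oddRow (tri> _ _ b<j) = ∑χ≡0 k e j (>⇒≢zero i<j)
      (cong₂ _xor_ (cong₂ _xor_ (δ-≢ (≢< i<j)) (δ-self j)) (cong₂ _xor_ (δ-≢ (≢< (<-trans a<b b<j))) (δ-≢ (≢< b<j))))
    oddRow (tri≈ _ refl _) with <-cmp i a
    ... | tri< i<a _ _ = ∑χ≡0 k e a (>⇒≢zero i<a)
      (cong₂ _xor_ (cong₂ _xor_ (δ-≢ (≢< i<a)) (δ-≢ (<⇒≢ a<b))) (cong₂ _xor_ (δ-self a) (δ-≢ (<⇒≢ a<b))))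
    ... | tri> _ _ a<i = ∑χ≡0 k e i (>⇒≢zero a<i)
      (cong₂ _xor_ (cong₂ _xor_ (δ-self i) (δ-≢ (<⇒≢ i<j))) (cong₂ _xor_ (δ-≢ (≢< a<i)) (δ-≢ (<⇒≢ i<j))))
    ... | tri≈ _ refl _ = ⊥-elim (ij≢ab refl)

  -- Doubling makes the multiplicity affine in the sign s, namely (U + V) + (U - V) s.
  signWeight : ℕ → ℕ → ℚ → ℕ
  signWeight U V s = if does (s ≟ 1ℚ) then U ℕ.+ U else V ℕ.+ V

  signWeight-·1 : ∀ U V {s} → IsSign s → signWeight U V s · 1ℚ ≡ (U · 1ℚ + V · 1ℚ) + (U · 1ℚ - V · 1ℚ) * s
  signWeight-·1 U V (inj₁ refl) = trans (×-homo-+ 1ℚ U U)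
    (solve 2 (λ u v → u :+ u := (u :+ v) :+ (u :- v) :* con 1ℚ) refl (U · 1ℚ) (V · 1ℚ))
  signWeight-·1 U V (inj₂ refl) = trans (×-homo-+ 1ℚ V V)
    (solve 2 (λ u v → v :+ v := (u :+ v) :+ (u :- v) :* con (- 1ℚ)) refl (U · 1ℚ) (V · 1ℚ))

  module _ (k : ℕ) (u v : Fin (suc k) → Fin (suc k) → ℕ) where

    pairColumns : Fin (suc k) → Fin (suc k) → List (Fin (pow2 k))
    pairColumns i j = concat (tabulate λ c → replicate (signWeight (u i j) (v i j) (TT k i j c)) c)

    -- The decision is an argument, not an `if`, so that proofs can split on it.
    blockIf : ∀ {i j} → Dec (i Fin.< j) → List (Fin (pow2 k))
    blockIf {i} {j} (yes _) = pairColumns i j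
    blockIf         (no _)  = []

    block : Fin (suc k) → Fin (suc k) → List (Fin (pow2 k))
    block i j = blockIf (i Fin.<? j)

    columns : List (Fin (pow2 k))
    columns = concat (tabulate λ i → concat (tabulate λ j → block i j))

    pairColumns-gram : ∀ i j {a b} → a Fin.< b →
      sumOver (TT k a b) (pairColumns i j) ≡ (u i j · 1ℚ - v i j · 1ℚ) * ∑[ c < pow2 k ] (TT k i j c * TT k a b c)
    pairColumns-gram i j {a} {b} a<b = begin
      sumOver (TT k a b) (pairColumns i j)
        ≡⟨ sumOver-concat-tabulate (TT k a b) (pow2 k) (λ c → replicate (w c) c) ⟩
      ∑[ c < pow2 k ] sumOver (TT k a b) (replicate (w c) c)
        ≡⟨ sum-cong-≗ expand ⟩
      ∑[ c < pow2 k ] (P * TT k a b c + D * (TT k i j c * TT k a b c))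
        ≡⟨ ∑-distrib-+ (λ c → P * TT k a b c) (λ c → D * (TT k i j c * TT k a b c)) ⟩
      ∑[ c < pow2 k ] (P * TT k a b c) + ∑[ c < pow2 k ] (D * (TT k i j c * TT k a b c))
        ≡⟨ cong₂ _+_ (sym (*-distribˡ-sum P (TT k a b))) (sym (*-distribˡ-sum D (λ c → TT k i j c * TT k a b c))) ⟩
      P * ∑[ c < pow2 k ] TT k a b c + D * Σij
        ≡⟨ cong (λ x → P * x + D * Σij) (∑TT≡0 k a<b) ⟩
      P * 0ℚ + D * Σij
        ≡⟨ trans (cong (_+ D * Σij) (*-zeroʳ P)) (+-identityˡ (D * Σij)) ⟩
      D * Σij ∎
      where
      w : Fin (pow2 k) → ℕ
      w c = signWeight (u i j) (v i j) (TT k i j c)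
      P D Σij : ℚ
      P = u i j · 1ℚ + v i j · 1ℚ
      D = u i j · 1ℚ - v i j · 1ℚ
      Σij = ∑[ c < pow2 k ] (TT k i j c * TT k a b c)
      expand : ∀ c → sumOver (TT k a b) (replicate (w c) c) ≡ P * TT k a b c + D * (TT k i j c * TT k a b c)
      expand c = begin
        sumOver (TT k a b) (replicate (w c) c)  ≡⟨ sumOver-replicate (TT k a b) (w c) c ⟩
        w c · TT k a b c                        ≡⟨ ·-as-* (w c) _ ⟩
        w c · 1ℚ * TT k a b c                   ≡⟨ cong (_* TT k a b c) (signWeight-·1 (u i j) (v i j) (TT-sign k i j c)) ⟩
        (P + D * TT k i j c) * TT k a b c       ≡⟨ solve 4 (λ p d s t → (p :+ d :* s) :* t := p :* t :+ d :* (s :* t)) refl P D (TT k i j c) (TT k a b c) ⟩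
        P * TT k a b c + D * (TT k i j c * TT k a b c) ∎

    block-gram-≢ : ∀ {i j a b} (i<?j : Dec (i Fin.< j)) → a Fin.< b → (i , j) ≢ (a , b) →
      sumOver (TT k a b) (blockIf i<?j) ≡ 0ℚ
    block-gram-≢ {i} {j} (yes i<j) a<b ij≢ab =
      trans (pairColumns-gram i j a<b) (trans (cong (D *_) (∑TT*TT≡0 k i<j a<b ij≢ab)) (*-zeroʳ D))
      where
      D : ℚ
      D = u i j · 1ℚ - v i j · 1ℚ
    block-gram-≢ (no _) a<b ij≢ab = refl

    block-gram-≡ : ∀ {a b} (a<?b : Dec (a Fin.< b)) → a Fin.< b →
      sumOver (TT k a b) (blockIf a<?b) ≡ (u a b · 1ℚ - v a b · 1ℚ) * pow2 k · 1ℚ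
    block-gram-≡ {a} {b} (yes _) a<b =
      trans (pairColumns-gram a b a<b) (cong ((u a b · 1ℚ - v a b · 1ℚ) *_) (∑TT*TT≡pow2 k a b))
    block-gram-≡ (no a≮b) a<b = ⊥-elim (a≮b a<b)

    columns-gram : ∀ {a b} → a Fin.< b → sumOver (TT k a b) columns ≡ (u a b · 1ℚ - v a b · 1ℚ) * pow2 k · 1ℚ
    columns-gram {a} {b} a<b = begin
      sumOver f columns
        ≡⟨ sumOver-concat-tabulate f (suc k) (λ i → concat (tabulate (block i))) ⟩
      ∑[ i < suc k ] sumOver f (concat (tabulate (block i)))
        ≡⟨ sum-cong-≗ (λ i → sumOver-concat-tabulate f (suc k) (block i)) ⟩
      ∑[ i < suc k ] ∑[ j < suc k ] sumOver f (block i j)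
        ≡⟨ ∑-δ (λ i → ∑[ j < suc k ] sumOver f (block i j)) a (λ i i≢a →
             ∑-zero (λ j → sumOver f (block i j)) (λ j → block-gram-≢ (i Fin.<? j) a<b (i≢a ∘ cong proj₁))) ⟩
      ∑[ j < suc k ] sumOver f (block a j)
        ≡⟨ ∑-δ (λ j → sumOver f (block a j)) b (λ j j≢b → block-gram-≢ (a Fin.<? j) a<b (j≢b ∘ cong proj₂)) ⟩
      sumOver f (block a b)
        ≡⟨ block-gram-≡ (a Fin.<? b) a<b ⟩
      (u a b · 1ℚ - v a b · 1ℚ) * pow2 k · 1ℚ ∎
      where
      f : Fin (pow2 k) → ℚ
      f = TT k a b

  pow2-nonZero : ∀ k → ℕ.NonZero (pow2 k)
  pow2-nonZero zero    = _
  pow2-nonZero (suc k) = ℕ.>-nonZero (ℕₚ.<-≤-trans (ℕ.>-nonZero⁻¹ (pow2 k) {{pow2-nonZero k}}) (ℕₚ.m≤m+n (pow2 k) (pow2 k)))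

  *-sign : ∀ r {s} → IsSign s → r * s ≡ r ⊎ r * s ≡ - r
  *-sign r (inj₁ refl) = inj₁ (*-identityʳ r)
  *-sign r (inj₂ refl) = inj₂ (trans (sym (neg-distribʳ-* r 1ℚ)) (cong -_ (*-identityʳ r)))

  GramRealization : ∀ k → (Fin (suc k) → Fin (suc k) → ℚ) → Set
  GramRealization k b =
    Σ ℚ λ r → Σ ℕ λ n → Σ (Matrix (suc k) n) λ M →
      Hadamardesque (suc k) n M
      × (∀ i j → M i j ≡ r ⊎ M i j ≡ - r)
      × (∀ i j → i Fin.< j → dot n (M i) (M j) ≡ b i j)

  realize : ∀ k b → GramRealization k b
  realize k b = r , length cols , M , hadamardesque , signs , gram
    where
    common : ∃ λ D → ∀ x → IsInteger (suc D · 1ℚ * uncurry b (remQuot (suc k) x))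
    common = commonDenominator _ (λ x → uncurry b (remQuot (suc k) x))
    D : ℕ
    D = proj₁ common
    integral : ∀ i j → IsInteger (suc D · 1ℚ * b i j)
    integral i j = subst (λ ij → IsInteger (suc D · 1ℚ * uncurry b ij)) (remQuot-combine i j) (proj₂ common (combine i j))
    N : ℕ
    N = pow2 k ℕ.* suc D
    instance
      N≢0 : ℕ.NonZero N
      N≢0 = ℕₚ.m*n≢0 (pow2 k) (suc D) {{pow2-nonZero k}}
      N-pos : Positive (N · 1ℚ)
      N-pos = ·1-positive N
      N≢0ℚ : ℚ.NonZero (N · 1ℚ)
      N≢0ℚ = pos⇒nonZero (N · 1ℚ)
    U V : Fin (suc k) → Fin (suc k) → ℕ
    U i j = N ℕ.* proj₁ (integral i j)
    V i j = N ℕ.* proj₁ (proj₂ (integral i j))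
    cols : List (Fin (pow2 k))
    cols = columns k U V
    r : ℚ
    r = 1/ (N · 1ℚ)
    M : Matrix (suc k) (length cols)
    M row col = r * T k row (lookup cols col)
    hadamardesque : Hadamardesque (suc k) (length cols) M
    hadamardesque col = r , positive⁻¹ r {{1/pos⇒pos (N · 1ℚ)}} , lookup cols col , λ _ → refl
    signs : ∀ i j → M i j ≡ r ⊎ M i j ≡ - r
    signs i col = *-sign r (T-sign k i (lookup cols col))
    gram : ∀ i j → i Fin.< j → dot (length cols) (M i) (M j) ≡ b i j
    gram i j i<j = begin
      dot (length cols) (M i) (M j)
        ≡⟨ dot-lookup r (T k i) (T k j) cols ⟩
      r * r * sumOver (TT k i j) cols
        ≡⟨ cong (r * r *_) (columns-gram k U V i<j) ⟩
      r * r * (((N ℕ.* u) · 1ℚ - (N ℕ.* v) · 1ℚ) * pow2 k · 1ℚ)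
        ≡⟨ cong (λ x → r * r * (x * pow2 k · 1ℚ)) (trans (·1-*-difference N u v) (cong (N · 1ℚ *_) (sym Db≡u-v))) ⟩
      r * r * (N · 1ℚ * (suc D · 1ℚ * b i j) * pow2 k · 1ℚ)
        ≡⟨ cong (λ x → r * r * (x * (suc D · 1ℚ * b i j) * pow2 k · 1ℚ)) (×1-homo-* (pow2 k) (suc D)) ⟩
      r * r * (P * Q * (Q * b i j) * P)
        ≡⟨ solve 4 (λ r p q x → r :* r :* (p :* q :* (q :* x) :* p) := (r :* (p :* q)) :* (r :* (p :* q)) :* x) refl r P Q (b i j) ⟩
      (r * (P * Q)) * (r * (P * Q)) * b i j
        ≡⟨ cong (λ x → x * x * b i j) (trans (cong (r *_) (sym (×1-homo-* (pow2 k) (suc D)))) (*-inverseˡ (N · 1ℚ))) ⟩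
      1ℚ * 1ℚ * b i j
        ≡⟨ *-identityˡ (b i j) ⟩
      b i j ∎
      where
      P Q : ℚ
      P = pow2 k · 1ℚ
      Q = suc D · 1ℚ
      u v : ℕ
      u = proj₁ (integral i j)
      v = proj₁ (proj₂ (integral i j))
      Db≡u-v : suc D · 1ℚ * b i j ≡ u · 1ℚ - v · 1ℚ
      Db≡u-v = proj₂ (proj₂ (integral i j))

open import Data.Nat using (_≤_; _*_; _∸_; _+_)
open import Data.Nat.DivMod using (_/_)
open import Data.Rational using (ℚ; 0ℚ; -_)

pairIndex : ∀ {m} → Fin m → Fin m → ℕ
pairIndex i j = (toℕ j * (toℕ j ∸ 1)) / 2 + toℕ i

entryAt : ∀ {N n} → (Fin N → ℚ) → Dec (∃ λ (x : Fin N) → toℕ x ≡ n) → ℚ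
entryAt a (yes (x , _)) = a x
entryAt a (no _)        = 0ℚ

entryAt-≡ : ∀ {N n} (a : Fin N → ℚ) {x} (x? : Dec (∃ λ (y : Fin N) → toℕ y ≡ n)) → toℕ x ≡ n → entryAt a x? ≡ a x
entryAt-≡ a {x} (yes (y , y↦n)) x↦n = cong a (toℕ-injective (trans y↦n (sym x↦n)))
entryAt-≡ a {x} (no ∄)          x↦n = ⊥-elim (∄ (x , x↦n))

-- a k becomes the target of the pair (i , j) with pairIndex i j ≡ toℕ k; pairs
-- without such an index impose nothing, so they get 0.
indexedTargets : ∀ {N m} → (Fin N → ℚ) → Fin m → Fin m → ℚ
indexedTargets a i j = entryAt a (any? (λ x → toℕ x ℕ.≟ pairIndex i j))

mainTheorem11 : (m : ℕ) → 2 ≤ m → (a : Fin ((m * (m ∸ 1)) / 2) → ℚ) →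
    Σ ℚ λ r → Σ ℕ λ n → Σ (Matrix m n) λ M →
      Hadamardesque m n M
      × ((i : Fin m) → (j : Fin n) → (M i j ≡ r) ⊎ (M i j ≡ - r))
      × ((i j : Fin m) → i Fin.< j → (k : Fin ((m * (m ∸ 1)) / 2)) →
           toℕ k ≡ (toℕ j * (toℕ j ∸ 1)) / 2 + toℕ i →
           dot n (M i) (M j) ≡ a k)
mainTheorem11 (suc k) _ a =
  let r , n , M , hadamardesque , signs , gram = realize k (indexedTargets a) in
  r , n , M , hadamardesque , signs ,
  λ i j i<j x x↦ij → trans (gram i j i<j) (entryAt-≡ a (any? (λ y → toℕ y ℕ.≟ pairIndex i j)) x↦ij)
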